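{- Let $L$ be a loop with runtime bound $\mathtt{rb}$ and let the transition $t_L$ correspond to $L$ via the variable renaming $\pi$. Then the function $\mathcal{RB}_{\mathrm{loc}}$ with $\mathcal{RB}_{\mathrm{loc}}(r) = \pi(\mathtt{rb})$ for all entry transitions $r \in \mathcal{E}_{\{t_L\}}$ is a local runtime bound for $\mathcal{T}'_> = \mathcal{T}' = \{t_L\}$ in the program.
   Context: Bounds: the set $\mathcal{B}$ of bounds is the smallest set containing $\mathbb{R}_{\geq 0}\cup\{\omega\}$ and all variables, and closed under $b_1+b_2$, $b_1\cdot b_2$, $k^{b_1}$, $\log_k(\max\{1,b_1\})$ and $\max\{b_1,\dots,b_m\}$ for $k\in\mathbb{R}_{>1}$; these are weakly monotonically increasing. States are maps $\sigma:\mathcal{V}\to\mathbb{Z}$, and $|\sigma|(v)=|\sigma(v)|$. A loop $L=(\varphi',\eta')$ over variables $\{x_1,\dots,x_d\}$ consists of a guard $\varphi'$ (a propositional formula over polynomial inequations) and an update $\eta':\{x_1,\dots,x_d\}\to\mathbb{Z}[x_1,\dots,x_d]$. Its runtime complexity is $\mathrm{rc}_L(\sigma)=\min\{n\in\mathbb{N}\mid \sigma(\eta'^n(\neg\varphi'))\}$ (with $\min\emptyset=\omega$), and $\mathtt{rb}\in\mathcal{B}$ is a runtime bound for $L$ if $|\sigma|(\mathtt{rb})\geq \mathrm{rc}_L(\sigma)$ for all states $\sigma$. An integer program $(\mathcal{V},\mathcal{TV},\mathcal{L},\ell_0,\mathcal{T})$ has program variables $\mathcal{V}$, temporary variables $\mathcal{TV}$,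 locations $\mathcal{L}$ with initial location $\ell_0$, and transitions $(\ell,\varphi,\eta,\ell')$ with guard $\varphi$ and update $\eta:\mathcal{V}\to\mathbb{Z}[\mathcal{V}\cup\mathcal{TV}]$; an evaluation step $(\ell,\sigma)\to_t(\ell',\sigma')$ by $t=(\ell,\varphi,\eta,\ell')$ requires $\sigma(\varphi)$ true and $\sigma'(v)=\sigma(\eta(v))$ for all $v\in\mathcal{V}$. A transition $t=(\ell,\varphi,\eta,\ell)$ with $\varphi$ over $\mathcal{V}'\subseteq\mathcal{V}$ and $\eta(v)\in\mathbb{Z}[\mathcal{V}']$ for all $v\in\mathcal{V}'$ corresponds to the loop $(\varphi',\eta')$ via a variable renaming $\pi:\{x_1,\dots,x_d\}\to\mathcal{V}'$ if $\varphi=\pi(\varphi')$ and $\eta(\pi(x_i))=\pi(\eta'(x_i))$ for all $i$. For $\emptyset\neq\mathcal{T}'\subseteq\mathcal{T}$ without initial transitions, the entry transitions $\mathcal{E}_{\mathcal{T}'}$ are the transitions $(\ell',\varphi,\eta,\ell)\in\mathcal{T}\setminus\mathcal{T}'$ such that some transition of $\mathcal{T}'$ starts in $\ell$. For $\emptyset\neq\mathcal{T}'_>\subseteq\mathcal{T}'$, a function $\mathcal{RB}_{\mathrm{loc}}:\mathcal{E}_{\mathcal{T}'}\to\mathcal{B}$ is a local runtime bound for $\mathcal{T}'_>$ w.r.t. $\mathcal{T}'$ if for all $t\in\mathcal{T}'_>$, all $r=(\ell',\_,\_,\ell)\in\mathcal{E}_{\mathcal{T}'}$ and all states $\sigma$: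 $|\sigma|(\mathcal{RB}_{\mathrm{loc}}(r))\geq\sup\{k\in\mathbb{N}\mid \exists\sigma',(\ell'',\sigma'').\ (\ell',\sigma')\to_r(\ell,\sigma)\,(\to_{\mathcal{T}'}^*\circ\to_t)^k\,(\ell'',\sigma'')\}$. -}

module Defs where

open import Level using (Level; 0ℓ) renaming (suc to lsuc)
open import Data.Nat as ℕ using (ℕ; zero; suc)
open import Data.Integer as ℤ using (ℤ; ∣_∣)
open import Data.Fin using (Fin)
open import Data.Sum using (_⊎_; inj₁; inj₂)
open import Data.Product using (Σ; ∃; ∃-syntax; _×_; _,_)
open import Data.List using (List)
open import Data.List.Membership.Propositional using (_∈_)
open import Data.Unit using (⊤)
open import Data.Empty using (⊥)
open import Function using (_∘_; _⇔_; Injective)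
open import Relation.Nullary using (¬_)
open import Relation.Binary.PropositionalEquality using (_≡_)

-- Polynomials with integer coefficients over a set X of variables
-- (as expressions; two polynomials of Z[X] are equal iff they agree as
-- functions on all integer assignments).

data Poly (X : Set) : Set where
  con  : ℤ → Poly X
  var  : X → Poly X
  _⊕_  : Poly X → Poly X → Poly X
  _⊗_  : Poly X → Poly X → Poly X

evalP : {X : Set} → (X → ℤ) → Poly X → ℤ
evalP σ (con c) = c
evalP σ (var x) = σ x
evalP σ (p ⊕ q) = evalP σ p ℤ.+ evalP σ q
evalP σ (p ⊗ q) = evalP σ p ℤ.* evalP σ q

substP : {X Y : Set} → (X → Poly Y) → Poly X → Poly Y
substP f (con c) = con c
substP f (var x) = f x
substP f (p ⊕ q) = substP f p ⊕ substP f q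
substP f (p ⊗ q) = substP f p ⊗ substP f q

renameP : {X Y : Set} → (X → Y) → Poly X → Poly Y
renameP f = substP (var ∘ f)

data Formula (X : Set) : Set where
  true false : Formula X
  _≤ᶠ_ : Poly X → Poly X → Formula X
  _<ᶠ_ : Poly X → Poly X → Formula X
  ¬ᶠ_  : Formula X → Formula X
  _∧ᶠ_ : Formula X → Formula X → Formula X
  _∨ᶠ_ : Formula X → Formula X → Formula X

Sat : {X : Set} → (X → ℤ) → Formula X → Set
Sat σ true = ⊤
Sat σ false = ⊥
Sat σ (p ≤ᶠ q) = evalP σ p ℤ.≤ evalP σ q
Sat σ (p <ᶠ q) = evalP σ p ℤ.< evalP σ q
Sat σ (¬ᶠ φ) = ¬ Sat σ φ
Sat σ (φ ∧ᶠ ψ) = Sat σ φ × Sat σ ψ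
Sat σ (φ ∨ᶠ ψ) = Sat σ φ Data.Sum.⊎ Sat σ ψ

substF : {X Y : Set} → (X → Poly Y) → Formula X → Formula Y
substF f true = true
substF f false = false
substF f (p ≤ᶠ q) = substP f p ≤ᶠ substP f q
substF f (p <ᶠ q) = substP f p <ᶠ substP f q
substF f (¬ᶠ φ) = ¬ᶠ substF f φ
substF f (φ ∧ᶠ ψ) = substF f φ ∧ᶠ substF f ψ
substF f (φ ∨ᶠ ψ) = substF f φ ∨ᶠ substF f ψ

renameF : {X Y : Set} → (X → Y) → Formula X → Formula Y
renameF f = substF (var ∘ f)

data ℕ∞ : Set where
  fin : ℕ → ℕ∞
  ω   : ℕ∞

IsMin : (ℕ → Set) → ℕ∞ → Set
IsMin S (fin n) = S n × (∀ j → S j → n ℕ.≤ j)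
IsMin S ω       = ∀ j → ¬ S j

-- m = sup S   (sup ∅ = 0, sup of an unbounded set = ω)
IsSup : (ℕ → Set) → ℕ∞ → Set
IsSup S (fin n) = (∀ j → S j → j ℕ.≤ n) × (∀ u → (∀ j → S j → j ℕ.≤ u) → n ℕ.≤ u)
IsSup S ω       = ∀ u → ¬ (∀ j → S j → j ℕ.≤ u)

-- Value domain for bounds: an abstract model of the non-negative reals
-- (the real numbers are not available in agda-stdlib). The theorem is
-- stated for every such model, in particular for ℝ.

record RealModel : Set₁ where
  field
    Carrier : Set
    _≤_     : Carrier → Carrier → Set
    _<_     : Carrier → Carrier → Set
    fromℕ   : ℕ → Carrier
    _+_     : Carrier → Carrier → Carrier
    _·_     : Carrier → Carrier → Carrier
    pow     : Carrier → Carrier → Carrier   -- pow k x = k ^ x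
    logb    : Carrier → Carrier → Carrier   -- logb k x = log_k x
    max     : Carrier → Carrier → Carrier
    ≤-refl   : ∀ {x} → x ≤ x
    ≤-trans  : ∀ {x y z} → x ≤ y → y ≤ z → x ≤ z
    fromℕ-mono : ∀ {m n} → m ℕ.≤ n → fromℕ m ≤ fromℕ n
    ≤-stable : ∀ {x y} → ¬ ¬ (x ≤ y) → x ≤ y

module _ (R : RealModel) where
  open RealModel R

  -- Bounds over variables X (max of finitely many bounds is built from
  -- the binary maximum).
  data Bound (X : Set) : Set where
    cst   : (c : Carrier) → fromℕ 0 ≤ c → Bound X
    ωᵇ    : Bound X
    varᵇ  : X → Bound X
    _+ᵇ_  : Bound X → Bound X → Bound X
    _·ᵇ_  : Bound X → Bound X → Bound X
    expᵇ  : (k : Carrier) → fromℕ 1 < k → Bound X → Bound X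
    logᵇ  : (k : Carrier) → fromℕ 1 < k → Bound X → Bound X
    maxᵇ  : Bound X → Bound X → Bound X

  data R∞ : Set where
    val : Carrier → R∞
    ω   : R∞

  lift₂ : (Carrier → Carrier → Carrier) → R∞ → R∞ → R∞
  lift₂ f (val x) (val y) = val (f x y)
  lift₂ f _ _ = ω

  lift₁ : (Carrier → Carrier) → R∞ → R∞
  lift₁ f (val x) = val (f x)
  lift₁ f ω = ω

  -- evaluation of a bound under the absolute values ν = |σ| of a state
  evalB : {X : Set} → (X → ℕ) → Bound X → R∞
  evalB ν (cst c _) = val c
  evalB ν ωᵇ = ω
  evalB ν (varᵇ x) = val (fromℕ (ν x))
  evalB ν (b +ᵇ c) = lift₂ _+_ (evalB ν b) (evalB ν c)
  evalB ν (b ·ᵇ c) = lift₂ _·_ (evalB ν b) (evalB ν c)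
  evalB ν (expᵇ k _ b) = lift₁ (pow k) (evalB ν b)
  evalB ν (logᵇ k _ b) = lift₁ (λ x → logb k (max (fromℕ 1) x)) (evalB ν b)
  evalB ν (maxᵇ b c) = lift₂ max (evalB ν b) (evalB ν c)

  renameB : {X Y : Set} → (X → Y) → Bound X → Bound Y
  renameB f (cst c p) = cst c p
  renameB f ωᵇ = ωᵇ
  renameB f (varᵇ x) = varᵇ (f x)
  renameB f (b +ᵇ c) = renameB f b +ᵇ renameB f c
  renameB f (b ·ᵇ c) = renameB f b ·ᵇ renameB f c
  renameB f (expᵇ k p b) = expᵇ k p (renameB f b)
  renameB f (logᵇ k p b) = logᵇ k p (renameB f b)
  renameB f (maxᵇ b c) = maxᵇ (renameB f b) (renameB f c)

  _≥∞_ : R∞ → ℕ∞ → Set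
  ω ≥∞ _ = ⊤
  val x ≥∞ fin n = fromℕ n ≤ x
  val x ≥∞ ω = ⊥

  abs : {X : Set} → (X → ℤ) → X → ℕ
  abs σ x = ∣ σ x ∣

record Loop : Set where
  field
    d      : ℕ
    guard  : Formula (Fin d)
    update : Fin d → Poly (Fin d)

module _ (L : Loop) where
  open Loop L

  updPow : ℕ → Formula (Fin d) → Formula (Fin d)
  updPow zero ψ = ψ
  updPow (suc n) ψ = substF update (updPow n ψ)

  IsRC : (Fin d → ℤ) → ℕ∞ → Set
  IsRC σ m = IsMin (λ n → Sat σ (updPow n (¬ᶠ guard))) m

IsRuntimeBound : (R : RealModel) (L : Loop) → Bound R (Fin (Loop.d L)) → Set
IsRuntimeBound R L rb =
  ∀ (σ : Fin (Loop.d L) → ℤ) (m : ℕ∞) → IsRC L σ m →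
    _≥∞_ R (evalB R (abs R σ) rb) m

record Transition (V TV Loc : Set) : Set where
  field
    src    : Loc
    guard  : Formula (V ⊎ TV)
    update : V → Poly (V ⊎ TV)
    tgt    : Loc

record Program : Set₁ where
  field
    V TV Loc : Set
    ℓ₀ : Loc
    T  : List (Transition V TV Loc)

module _ (P : Program) where
  open Program P

  Trans : Set
  Trans = Transition V TV Loc

  State : Set
  State = V ⊎ TV → ℤ

  Config : Set
  Config = Loc × State

  Step : Trans → Config → Config → Set
  Step t (ℓ , σ) (ℓ' , σ') =
    Transition.src t ≡ ℓ × Transition.tgt t ≡ ℓ' × Sat σ (Transition.guard t) ×
    (∀ v → σ' (inj₁ v) ≡ evalP σ (Transition.update t v))

  StepIn : (Trans → Set) → Config → Config → Set
  StepIn T' c c' = ∃[ t ] (T' t × Step t c c')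

  data Star (Rel : Config → Config → Set) : Config → Config → Set where
    ε   : ∀ {c} → Star Rel c c
    _◅_ : ∀ {c c' c''} → Rel c c' → Star Rel c' c'' → Star Rel c c''

  Comp : (Config → Config → Set) → (Config → Config → Set) → Config → Config → Set
  Comp R₁ R₂ c c'' = ∃[ c' ] (R₁ c c' × R₂ c' c'')

  RelPow : (Config → Config → Set) → ℕ → Config → Config → Set
  RelPow Rel zero c c' = c ≡ c'
  RelPow Rel (suc k) c c'' = Comp Rel (RelPow Rel k) c c''

  IsEntry : (Trans → Set) → Trans → Set
  IsEntry T' r = r ∈ T × ¬ T' r × ∃[ t ] (T' t × Transition.tgt r ≡ Transition.src t)

  IsLocalRuntimeBound : (R : RealModel) (T' T'> : Trans → Set) →
    ((r : Trans) → IsEntry T' r → Bound R V) → Set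
  IsLocalRuntimeBound R T' T'> RB =
    ∀ (t : Trans) → T'> t → ∀ (r : Trans) (e : IsEntry T' r) (σ : State) (m : ℕ∞) →
      IsSup (λ k → ∃[ σ' ] ∃[ c'' ]
                (Step r (Transition.src r , σ') (Transition.tgt r , σ) ×
                 RelPow (Comp (Star (StepIn T')) (Step t)) k (Transition.tgt r , σ) c''))
            m →
      _≥∞_ R (evalB R (abs R (σ ∘ inj₁)) (RB r e)) m

  Corresponds : Trans → (L : Loop) → (Fin (Loop.d L) → V) → Set
  Corresponds t L π =
    Transition.src t ≡ Transition.tgt t ×
    Injective _≡_ _≡_ π ×
    (∀ (σ : State) → Sat σ (Transition.guard t) ⇔ Sat σ (renameF (inj₁ ∘ π) (Loop.guard L))) ×
    (∀ (i : Fin (Loop.d L)) (σ : State) →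
       evalP σ (Transition.update t (π i)) ≡ evalP σ (renameP (inj₁ ∘ π) (Loop.update L i)))

-- Every run of t_L projects, along π, to a run of the loop L, and a loop state
-- satisfying η'^N(¬φ') can perform at most N iterations. Hence a run entering
-- t_L in σ performs at most rc_L(σ ∘ π) iterations, which rb bounds. Neither
-- the entry step nor t_L ∈ 𝒯 and src t_L ≠ ℓ₀ are needed: the bound holds from
-- every state. The only classical step is the existence of rc_L, the minimum
-- of a decidable set of naturals; it exists up to double negation, which
-- suffices because the goal inequality is ¬¬-stable.
module Submission where

open import Defs
open import Data.Fin using (Fin)
open import Data.List.Membership.Propositional using (_∈_)
open import Data.Nat as ℕ using (ℕ; zero; suc; z≤n; s≤s)
open import Data.Nat.Properties using (≤-refl; ≤-trans; m≤n⇒m≤1+n; m≤n⇒m<n∨m≡n; m<1+n⇒m≤n; ≮⇒≥)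
open import Data.Integer as ℤ using (ℤ)
open import Data.Integer.Properties using (_≤?_; _<?_)
open import Data.Sum using (_⊎_; inj₁; inj₂; [_,_])
open import Data.Product using (∃; ∃-syntax; _×_; _,_; proj₁; proj₂)
open import Data.Unit using (tt)
open import Data.Empty using (⊥-elim)
open import Function using (id; _∘_; _$_; _⇔_; Equivalence; mk⇔)
open import Relation.Nullary using (¬_; yes; no)
open import Relation.Unary using (Decidable)
open import Relation.Binary.PropositionalEquality
  using (_≡_; refl; sym; cong; cong₂; subst; module ≡-Reasoning)

open Equivalence using (to; from)

evalP-substP : {X Y : Set} {f : X → Poly Y} {σ : Y → ℤ} {τ : X → ℤ} →
  (∀ x → evalP σ (f x) ≡ τ x) → ∀ p → evalP σ (substP f p) ≡ evalP τ p
evalP-substP h (con c) = refl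
evalP-substP h (var x) = h x
evalP-substP h (p ⊕ q) = cong₂ ℤ._+_ (evalP-substP h p) (evalP-substP h q)
evalP-substP h (p ⊗ q) = cong₂ ℤ._*_ (evalP-substP h p) (evalP-substP h q)

Sat-substF : {X Y : Set} {f : X → Poly Y} {σ : Y → ℤ} {τ : X → ℤ} →
  (∀ x → evalP σ (f x) ≡ τ x) → ∀ φ → Sat σ (substF f φ) ⇔ Sat τ φ
Sat-substF h true = mk⇔ id id
Sat-substF h false = mk⇔ id id
Sat-substF {f = f} {σ} h (p ≤ᶠ q)
  with evalP σ (substP f p) | evalP-substP {f = f} h p
     | evalP σ (substP f q) | evalP-substP {f = f} h q
... | _ | refl | _ | refl = mk⇔ id id
Sat-substF {f = f} {σ} h (p <ᶠ q)
  with evalP σ (substP f p) | evalP-substP {f = f} h p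
     | evalP σ (substP f q) | evalP-substP {f = f} h q
... | _ | refl | _ | refl = mk⇔ id id
Sat-substF h (¬ᶠ φ) = mk⇔ (λ ¬s s → ¬s (from (Sat-substF h φ) s))
                          (λ ¬s s → ¬s (to (Sat-substF h φ) s))
Sat-substF h (φ ∧ᶠ ψ) =
  mk⇔ (λ (a , b) → to (Sat-substF h φ) a , to (Sat-substF h ψ) b)
      (λ (a , b) → from (Sat-substF h φ) a , from (Sat-substF h ψ) b)
Sat-substF h (φ ∨ᶠ ψ) =
  mk⇔ [ inj₁ ∘ to (Sat-substF h φ) , inj₂ ∘ to (Sat-substF h ψ) ]
      [ inj₁ ∘ from (Sat-substF h φ) , inj₂ ∘ from (Sat-substF h ψ) ]

Sat? : {X : Set} (σ : X → ℤ) → Decidable (Sat σ)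
Sat? σ true = yes tt
Sat? σ false = no id
Sat? σ (p ≤ᶠ q) = evalP σ p ≤? evalP σ q
Sat? σ (p <ᶠ q) = evalP σ p <? evalP σ q
Sat? σ (¬ᶠ φ) with Sat? σ φ
... | yes s = no (λ ¬s → ¬s s)
... | no ¬s = yes ¬s
Sat? σ (φ ∧ᶠ ψ) with Sat? σ φ | Sat? σ ψ
... | yes a | yes b = yes (a , b)
... | no ¬a | _     = no (¬a ∘ proj₁)
... | _     | no ¬b = no (¬b ∘ proj₂)
Sat? σ (φ ∨ᶠ ψ) with Sat? σ φ | Sat? σ ψ
... | yes a | _     = yes (inj₁ a)
... | _     | yes b = yes (inj₂ b)
... | no ¬a | no ¬b = no [ ¬a , ¬b ]

module _ (R : RealModel) where
  open RealModel R
    using (_+_; _·_; pow; logb; max; fromℕ; fromℕ-mono; ≤-stable)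
    renaming (≤-trans to ≤ᴿ-trans)

  evalB-renameB : {X Y : Set} (π : X → Y) (ν : Y → ℕ) (b : Bound R X) →
    evalB R ν (renameB R π b) ≡ evalB R (ν ∘ π) b
  evalB-renameB π ν (cst c _) = refl
  evalB-renameB π ν ωᵇ = refl
  evalB-renameB π ν (varᵇ x) = refl
  evalB-renameB π ν (b +ᵇ c) =
    cong₂ (lift₂ R _+_) (evalB-renameB π ν b) (evalB-renameB π ν c)
  evalB-renameB π ν (b ·ᵇ c) =
    cong₂ (lift₂ R _·_) (evalB-renameB π ν b) (evalB-renameB π ν c)
  evalB-renameB π ν (expᵇ k _ b) = cong (lift₁ R (pow k)) (evalB-renameB π ν b)
  evalB-renameB π ν (logᵇ k _ b) =
    cong (lift₁ R (λ x → logb k (max (fromℕ 1) x))) (evalB-renameB π ν b)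
  evalB-renameB π ν (maxᵇ b c) =
    cong₂ (lift₂ R max) (evalB-renameB π ν b) (evalB-renameB π ν c)

  ≥∞-stable : ∀ x m → ¬ ¬ (_≥∞_ R x m) → _≥∞_ R x m
  ≥∞-stable ω       m       _     = tt
  ≥∞-stable (val x) (fin n) ¬¬x≥n = ≤-stable ¬¬x≥n
  ≥∞-stable (val _) ω       ¬¬⊥   = ¬¬⊥ id

  ≥∞-IsSup-IsMin : ∀ {S Q : ℕ → Set} {m n∞} x → IsSup S m → IsMin Q n∞ →
    (∀ N → Q N → ∀ k → S k → k ℕ.≤ N) → _≥∞_ R x n∞ → _≥∞_ R x m
  ≥∞-IsSup-IsMin ω _ _ _ _ = tt
  ≥∞-IsSup-IsMin {n∞ = ω} (val _) _ _ _ ()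
  ≥∞-IsSup-IsMin {m = fin n} {fin N} (val x) (_ , n≤upperBounds) (QN , _) bounds N≤x =
    ≤ᴿ-trans (fromℕ-mono (n≤upperBounds N (bounds N QN))) N≤x
  ≥∞-IsSup-IsMin {m = ω} {fin N} (val x) unbounded (QN , _) bounds _ =
    unbounded N (bounds N QN)

module _ {Q : ℕ → Set} (Q? : Decidable Q) where

  least-or-none : ∀ n → (∃[ m ] IsMin Q (fin m)) ⊎ (∀ j → j ℕ.≤ n → ¬ Q j)
  least-or-none zero with Q? zero
  ... | yes Q0 = inj₁ (zero , Q0 , λ _ _ → z≤n)
  ... | no ¬Q0 = inj₂ λ { .zero z≤n → ¬Q0 }
  least-or-none (suc n) with least-or-none n
  ... | inj₁ least = inj₁ least
  ... | inj₂ none≤n with Q? (suc n)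
  ...   | yes Q1+n =
    inj₁ (suc n , Q1+n , λ j Qj → ≮⇒≥ (λ j<1+n → none≤n j (m<1+n⇒m≤n j<1+n) Qj))
  ...   | no ¬Q1+n =
    inj₂ λ j j≤1+n → [ none≤n j ∘ m<1+n⇒m≤n , (λ { refl → ¬Q1+n }) ] (m≤n⇒m<n∨m≡n j≤1+n)

  IsMin-¬¬exists : ¬ ¬ ∃ (IsMin Q)
  IsMin-¬¬exists ¬min = ¬min (ω , λ j Qj →
    [ (λ (m , isMin) → ¬min (fin m , isMin)) , (λ none≤j → none≤j j ≤-refl Qj) ]
      (least-or-none j))

module _ (L : Loop) where
  open Loop L

  LoopStep : (Fin d → ℤ) → (Fin d → ℤ) → Set
  LoopStep σ σ' = Sat σ guard × (∀ i → evalP σ (update i) ≡ σ' i)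

  GuardFailsAfter : ℕ → (Fin d → ℤ) → Set
  GuardFailsAfter N σ = Sat σ (updPow L N (¬ᶠ guard))

  GuardFailsAfter-LoopStep : ∀ {N σ σ'} → LoopStep σ σ' → GuardFailsAfter N σ →
    ∃[ N' ] (N ≡ suc N' × GuardFailsAfter N' σ')
  GuardFailsAfter-LoopStep {zero} (guardHolds , _) guardFails = ⊥-elim (guardFails guardHolds)
  GuardFailsAfter-LoopStep {suc N} (_ , updates) guardFails =
    N , refl , to (Sat-substF updates (updPow L N (¬ᶠ guard))) guardFails

module _ (P : Program) (rank : ℕ → Config P → Set) where

  RankDecreasing : (Config P → Config P → Set) → Set
  RankDecreasing Rel = ∀ {N} c c' → Rel c c' → rank N c → ∃[ N' ] (N ≡ suc N' × rank N' c')

  Star-rank-≤ : ∀ {Rel c c' N} → RankDecreasing Rel → Star P Rel c c' → rank N c →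
    ∃[ N' ] (N' ℕ.≤ N × rank N' c')
  Star-rank-≤ dec ε r = _ , ≤-refl , r
  Star-rank-≤ dec (step ◅ steps) r with dec _ _ step r
  ... | N' , refl , r' with Star-rank-≤ dec steps r'
  ...   | N'' , N''≤N' , r'' = N'' , m≤n⇒m≤1+n N''≤N' , r''

  RelPow-≤-rank : ∀ {Rel Rel' c c' N} k → RelPow P (Comp P (Star P Rel) Rel') k c c' →
    rank N c → RankDecreasing Rel → RankDecreasing Rel' → k ℕ.≤ N
  RelPow-≤-rank zero _ _ _ _ = z≤n
  RelPow-≤-rank (suc k) (_ , (_ , steps , step) , run) r dec dec'
    with Star-rank-≤ dec steps r
  ... | N' , N'≤N , r' with dec' _ _ step r'
  ...   | N'' , refl , r'' = ≤-trans (s≤s (RelPow-≤-rank k run r'' dec dec')) N'≤N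

module _ (P : Program) (L : Loop) (π : Fin (Loop.d L) → Program.V P) (tL : Trans P) where
  open Loop L

  Step-LoopStep : Corresponds P tL L π → ∀ {ℓ ℓ' σ σ'} → Step P tL (ℓ , σ) (ℓ' , σ') →
    LoopStep L (σ ∘ inj₁ ∘ π) (σ' ∘ inj₁ ∘ π)
  Step-LoopStep (_ , _ , guard⇔ , update≡) {σ = σ} {σ'} (_ , _ , guardHolds , updates) =
    to (Sat-substF (λ _ → refl) guard) (to (guard⇔ σ) guardHolds) , updates-along-π
    where
      open ≡-Reasoning
      updates-along-π : ∀ i → evalP (σ ∘ inj₁ ∘ π) (update i) ≡ σ' (inj₁ (π i))
      updates-along-π i = begin
        evalP (σ ∘ inj₁ ∘ π) (update i)          ≡⟨ evalP-substP (λ _ → refl) (update i) ⟨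
        evalP σ (renameP (inj₁ ∘ π) (update i))  ≡⟨ update≡ i σ ⟨
        evalP σ (Transition.update tL (π i))     ≡⟨ updates (π i) ⟨
        σ' (inj₁ (π i))                          ∎

  LoopRank : ℕ → Config P → Set
  LoopRank N (_ , σ) = GuardFailsAfter L N (σ ∘ inj₁ ∘ π)

  Step-RankDecreasing : Corresponds P tL L π → RankDecreasing P LoopRank (Step P tL)
  Step-RankDecreasing cor (_ , σ) (_ , σ') step =
    GuardFailsAfter-LoopStep L (Step-LoopStep cor {σ = σ} {σ'} step)

  StepIn-RankDecreasing : Corresponds P tL L π → RankDecreasing P LoopRank (StepIn P (_≡ tL))
  StepIn-RankDecreasing cor c c' (_ , refl , step) = Step-RankDecreasing cor c c' step

corollary2 : (R : RealModel) (P : Program) (L : Loop) (rb : Bound R (Fin (Loop.d L)))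
    (tL : Trans P) (π : Fin (Loop.d L) → Program.V P) →
    IsRuntimeBound R L rb →
    tL ∈ Program.T P →
    ¬ (Transition.src tL ≡ Program.ℓ₀ P) →
    Corresponds P tL L π →
    IsLocalRuntimeBound P R (λ t → t ≡ tL) (λ t → t ≡ tL) (λ r _ → renameB R π rb)
corollary2 R P L rb tL π isRB _ _ cor .tL refl _ _ σ m isSup =
  subst (λ x → _≥∞_ R x m) (sym (evalB-renameB R π (abs R (σ ∘ inj₁)) rb)) $
  ≥∞-stable R bound m λ ¬bound≥m →
    IsMin-¬¬exists (λ N → Sat? σL (updPow L N (¬ᶠ Loop.guard L))) λ (rc , isRC) →
      ¬bound≥m (≥∞-IsSup-IsMin R bound isSup isRC
        (λ N guardFails k (_ , _ , _ , run) →
          RelPow-≤-rank P (LoopRank P L π tL) k run guardFails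
            (StepIn-RankDecreasing P L π tL cor) (Step-RankDecreasing P L π tL cor))
        (isRB σL rc isRC))
  where
    σL : Fin (Loop.d L) → ℤ
    σL = σ ∘ inj₁ ∘ π
    bound : R∞ R
    bound = evalB R (abs R σL) rb
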